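{- Let $H$ be a finite simple graph with positive integer edge weights such that there is no pair of vertices of $H$ between which there are two or more distinct geodesics of length $2$. Then there exists a weighted geodetic graph $G$ containing $H$ as an induced subgraph (the edges of $G$ between vertices of $H$ are exactly the edges of $H$, with the same weights), such that every edge of $G$ not belonging to $H$ has weight $1$ or $2$.
   Context: In an edge-weighted graph, the length of a path is the sum of the weights of its edges, and a geodesic between two vertices is a path of minimum length between them. A weighted graph is geodetic if between any two of its vertices there is exactly one geodesic. -}

module Defs where

open import Data.Nat using (ℕ; zero; suc; _+_; _≤_)
open import Data.Fin using (Fin)
open import Data.List using (List; []; _∷_)
open import Data.List.Relation.Unary.Unique.Propositional using (Unique)
open import Data.Product using (Σ; ∃; ∃-syntax; _×_; _,_)
open import Data.Sum using (_⊎_)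
open import Relation.Binary.PropositionalEquality using (_≡_; _≢_)
open import Relation.Nullary using (¬_)
open import Function.Definitions using (Injective)

-- Encoding: weight i j ≡ 0 means "no edge between i and j";
-- weight i j = w > 0 means "i and j are adjacent via an edge of weight w".
record WGraph : Set where
  field
    n      : ℕ
    weight : Fin n → Fin n → ℕ
    sym    : ∀ i j → weight i j ≡ weight j i
    loopless : ∀ i → weight i i ≡ 0
open WGraph public

Adj : (G : WGraph) → Fin (n G) → Fin (n G) → Set
Adj G i j = weight G i j ≢ 0

data IsWalk (G : WGraph) : Fin (n G) → Fin (n G) → List (Fin (n G)) → Set where
  here : ∀ {u} → IsWalk G u u (u ∷ [])
  step : ∀ {u w v vs} → Adj G u w → IsWalk G w v (w ∷ vs) → IsWalk G u v (u ∷ w ∷ vs)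

-- A path: a walk with no repeated vertices. In a simple graph a path is
-- determined by its vertex sequence, so paths are identified with vertex lists.
IsPath : (G : WGraph) → Fin (n G) → Fin (n G) → List (Fin (n G)) → Set
IsPath G u v vs = IsWalk G u v vs × Unique vs

len : (G : WGraph) → List (Fin (n G)) → ℕ
len G []           = 0
len G (x ∷ [])     = 0
len G (x ∷ y ∷ vs) = weight G x y + len G (y ∷ vs)

IsGeodesic : (G : WGraph) → Fin (n G) → Fin (n G) → List (Fin (n G)) → Set
IsGeodesic G u v vs = IsPath G u v vs × (∀ ws → IsPath G u v ws → len G vs ≤ len G ws)

Geodetic : WGraph → Set
Geodetic G = ∀ u v → Σ (List (Fin (n G))) λ vs →
  IsGeodesic G u v vs × (∀ ws → IsGeodesic G u v ws → ws ≡ vs)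

NoTwoGeodesicsOfLength2 : WGraph → Set
NoTwoGeodesicsOfLength2 H = ∀ u v (p q : List (Fin (n H))) →
  IsGeodesic H u v p → len H p ≡ 2 →
  IsGeodesic H u v q → len H q ≡ 2 → p ≡ q

InducedEmbedding : (H G : WGraph) → (Fin (n H) → Fin (n G)) → Set
InducedEmbedding H G f = Injective _≡_ _≡_ f × (∀ i j → weight G (f i) (f j) ≡ weight H i j)

NewEdgesWeight1or2 : (H G : WGraph) → (Fin (n H) → Fin (n G)) → Set
NewEdgesWeight1or2 H G f = ∀ x y → Adj G x y →
  ¬ (∃[ i ] ∃[ j ] (f i ≡ x × f j ≡ y × Adj H i j)) →
  weight G x y ≡ 1 ⊎ weight G x y ≡ 2

-- Call distinct vertices a, b of H far if they are joined neither by an edge of weight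
-- 1 or 2 nor by a path of two unit edges. Add a new vertex for every far pair and join it
-- to both members by unit edges; join every other pair involving a new vertex by an edge
-- of weight 2, unless the pair already has a unit path of length 2, in which case it stays
-- non-adjacent. Then any two vertices are joined by exactly one walk of length at most 2:
-- a unit edge, an edge of weight 2, or a path through a unique unit midpoint. As weights
-- are positive integers, that walk is their unique geodesic. The hypothesis on H is what
-- makes the unit midpoint of two old vertices unique.
module Submission where

open import Data.Bool using (true; false; if_then_else_)
open import Data.Empty using (⊥; ⊥-elim)
open import Data.Fin as Fin using (Fin)
open import Data.Fin.Properties using (<-cmp; <-asym; any?; all?; +↔⊎; *↔×)
open import Data.List using (List; []; _∷_)
open import Data.List.Relation.Unary.All using ([]; _∷_)
open import Data.List.Relation.Unary.AllPairs using ([]; _∷_)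
open import Data.Nat as ℕ using (ℕ; suc; _+_; _*_; _≤_; z≤n; s≤s)
open import Data.Nat.Properties
  using (+-identityʳ; ≤-refl; ≤-reflexive; ≤-trans; <-irrefl; <⇒≤; ≮⇒≥; n≤0⇒n≡0; m+n≡0⇒m≡0; m+n≤o⇒n≤o)
open import Data.Product using (Σ; ∃-syntax; _×_; _,_; proj₁; proj₂)
open import Data.Product.Properties using (≡-dec)
open import Data.Sum using (_⊎_; inj₁; inj₂; [_,_]′)
open import Data.Sum.Function.Propositional using (_⊎-↔_)
open import Data.Sum.Properties using (inj₁-injective)
open import Function using (_∘_; _↔_; Inverse; Injection; mk⇔)
open import Function.Properties.Inverse using (↔-refl; ↔-sym; ↔-trans; ↔⇒↣)
open import Relation.Binary.Definitions using (tri<; tri≈; tri>)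
open import Relation.Binary.PropositionalEquality
  using (_≡_; _≢_; refl; sym; trans; subst; subst₂; cong; cong₂)
open import Relation.Nullary using (¬_; Dec; yes; no; does; contradiction)
open import Relation.Nullary.Decidable using (¬?; _×-dec_; _⊎-dec_; dec-true; dec-false; does-⇔)

open import Defs hiding (sym)

Midpoint : {A : Set} → (A → A → ℕ) → A → A → A → Set
Midpoint w u m v = w u m ≡ 1 × w m v ≡ 1

ShortWeight : ℕ → Set
ShortWeight m = m ≡ 1 ⊎ m ≡ 2

data ShortRoute {A : Set} (w : A → A → ℕ) (u v : A) : Set where
  unit-edge       : w u v ≡ 1 → ShortRoute w u v
  double-edge     : w u v ≡ 2 → (∀ m → ¬ Midpoint w u m v) → ShortRoute w u v
  unique-midpoint : ∀ m → Midpoint w u m v → ¬ ShortWeight (w u v) →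
                    (∀ m′ → Midpoint w u m′ v → m′ ≡ m) → ShortRoute w u v

nonzero≤2⇒short : ∀ {m} → m ≢ 0 → m ≤ 2 → ShortWeight m
nonzero≤2⇒short {0}                 m≢0 _ = contradiction refl m≢0
nonzero≤2⇒short {1}                 _   _ = inj₁ refl
nonzero≤2⇒short {2}                 _   _ = inj₂ refl
nonzero≤2⇒short {suc (suc (suc _))} _   (s≤s (s≤s ()))

short⇒≤2 : ∀ {m} → ShortWeight m → m ≤ 2
short⇒≤2 (inj₁ refl) = s≤s z≤n
short⇒≤2 (inj₂ refl) = ≤-refl

zero⇒¬short : ∀ {m} → m ≡ 0 → ¬ ShortWeight m
zero⇒¬short refl (inj₁ ())
zero⇒¬short refl (inj₂ ())

suc⇒nonzero : ∀ {m k} → m ≡ suc k → m ≢ 0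
suc⇒nonzero refl ()

positive-sum≤2 : ∀ {p q} r → p ≢ 0 → q ≢ 0 → p + (q + r) ≤ 2 → p ≡ 1 × q ≡ 1 × r ≡ 0
positive-sum≤2 {0}             _       p≢0 _   _ = contradiction refl p≢0
positive-sum≤2 {suc _} {0}     _       _   q≢0 _ = contradiction refl q≢0
positive-sum≤2 {1}     {1}     0       _   _   _ = refl , refl , refl
positive-sum≤2 {1}     {1}     (suc _) _   _   (s≤s (s≤s ()))
positive-sum≤2 {1}     {suc (suc _)} _ _   _   (s≤s (s≤s ()))
positive-sum≤2 {suc (suc p)} {suc q} r _ _ (s≤s (s≤s le)) with () ← m+n≤o⇒n≤o p le

if-both : ∀ {A : Set} {P : A → Set} b {x y} → P x → P y → P (if b then x else y)
if-both true  px _  = px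
if-both false _  py = py

if-does-resolve : ∀ {A P : Set} (p : Dec P) {x y z : A} → y ≢ z → (if does p then x else y) ≡ z → P
if-does-resolve (yes p) _   _  = p
if-does-resolve (no _)  y≢z eq = contradiction eq y≢z

module _ {A : Set} {w : A → A → ℕ} (w-sym : ∀ u v → w u v ≡ w v u) where

  midpoint-sym : ∀ {u m v} → Midpoint w u m v → Midpoint w v m u
  midpoint-sym {u} {m} {v} (um , mv) = trans (w-sym v m) mv , trans (w-sym m u) um

  shortRoute-sym : ∀ {u v} → ShortRoute w u v → ShortRoute w v u
  shortRoute-sym {u} {v} (unit-edge w≡1) = unit-edge (trans (w-sym v u) w≡1)
  shortRoute-sym {u} {v} (double-edge w≡2 none) =
    double-edge (trans (w-sym v u) w≡2) (λ m → none m ∘ midpoint-sym)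
  shortRoute-sym {u} {v} (unique-midpoint m mid ¬short unique) =
    unique-midpoint m (midpoint-sym mid) (¬short ∘ subst ShortWeight (w-sym v u))
      (λ m′ → unique m′ ∘ midpoint-sym)

module _ {A B : Set} (e : B ↔ A) {w : A → A → ℕ} where
  open Inverse e

  shortRoute-reindex : ∀ {u v} → ShortRoute w (to u) (to v) →
                       ShortRoute (λ i j → w (to i) (to j)) u v
  shortRoute-reindex (unit-edge w≡1) = unit-edge w≡1
  shortRoute-reindex (double-edge w≡2 none) = double-edge w≡2 (none ∘ to)
  shortRoute-reindex {u} {v} (unique-midpoint m mid ¬short unique) =
    unique-midpoint (from m)
      (subst (λ z → Midpoint w (to u) z (to v)) (sym (strictlyInverseˡ m)) mid) ¬short
      (λ m′ mid′ → trans (sym (strictlyInverseʳ m′)) (cong from (unique (to m′) mid′)))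

module _ (G : WGraph) where

  unit-weight⇒distinct : ∀ {a b} → weight G a b ≡ 1 → a ≢ b
  unit-weight⇒distinct {a} w≡1 refl with () ← trans (sym w≡1) (loopless G a)

  edge-len : ∀ {u v} → len G (u ∷ v ∷ []) ≡ weight G u v
  edge-len = +-identityʳ _

  midpoint-len : ∀ {u m v} → Midpoint (weight G) u m v → len G (u ∷ m ∷ v ∷ []) ≡ 2
  midpoint-len (um , mv) = cong₂ _+_ um (cong (_+ 0) mv)

  edge-path : ∀ {u v} → weight G u v ≢ 0 → u ≢ v → IsPath G u v (u ∷ v ∷ [])
  edge-path adj u≢v = step adj here , (u≢v ∷ []) ∷ [] ∷ []

  midpoint-path : ∀ {u m v} → Midpoint (weight G) u m v → u ≢ v → IsPath G u v (u ∷ m ∷ v ∷ [])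
  midpoint-path (um , mv) u≢v =
    step (suc⇒nonzero um) (step (suc⇒nonzero mv) here) ,
    (unit-weight⇒distinct um ∷ u≢v ∷ []) ∷ (unit-weight⇒distinct mv ∷ []) ∷ [] ∷ []

  trivial-walk : ∀ {u v Q} → IsWalk G u v Q → len G Q ≤ 0 → Q ≡ u ∷ []
  trivial-walk here                 _  = refl
  trivial-walk (step {u} {w} adj _) le = contradiction (m+n≡0⇒m≡0 (weight G u w) (n≤0⇒n≡0 le)) adj

  data ShortWalk (u v : Fin (n G)) : List (Fin (n G)) → Set where
    edge : ShortWeight (weight G u v) → ShortWalk u v (u ∷ v ∷ [])
    via  : ∀ m → Midpoint (weight G) u m v → ShortWalk u v (u ∷ m ∷ v ∷ [])

  short-walk : ∀ {u v Q} → IsWalk G u v Q → u ≢ v → len G Q ≤ 2 → ShortWalk u v Q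
  short-walk here u≢u _ = contradiction refl u≢u
  short-walk (step adj here) _ le = edge (nonzero≤2⇒short adj (subst (_≤ 2) edge-len le))
  short-walk (step adj (step adj′ here)) _ le with positive-sum≤2 0 adj adj′ le
  ... | um , mv , _ = via _ (um , mv)
  short-walk (step adj (step adj′ (step {u} {w} adj″ _))) _ le with positive-sum≤2 _ adj adj′ le
  ... | _ , _ , rest≡0 = contradiction (m+n≡0⇒m≡0 (weight G u w) rest≡0) adj″

  length≥2 : ∀ {a b Q} → weight G a b ≢ 1 → a ≢ b → IsWalk G a b Q → 2 ≤ len G Q
  length≥2 {a} {b} w≢1 a≢b walk = ≮⇒≥ λ lt → below-2 (short-walk walk a≢b (<⇒≤ lt)) lt
    where
    below-2 : ∀ {Q} → ShortWalk a b Q → ¬ len G Q ℕ.< 2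
    below-2 (edge (inj₁ w≡1)) _  = w≢1 w≡1
    below-2 (edge (inj₂ w≡2)) lt = <-irrefl (trans edge-len w≡2) lt
    below-2 (via _ mid)       lt = <-irrefl (midpoint-len mid) lt

  length-2-geodesic : ∀ {a b P} → weight G a b ≢ 1 → a ≢ b →
                      IsPath G a b P → len G P ≡ 2 → IsGeodesic G a b P
  length-2-geodesic w≢1 a≢b path P≡2 =
    path , λ Q q → subst (_≤ len G Q) (sym P≡2) (length≥2 w≢1 a≢b (proj₁ q))

  midpoint-geodesic : ∀ {a m b} → weight G a b ≢ 1 → a ≢ b →
                      Midpoint (weight G) a m b → IsGeodesic G a b (a ∷ m ∷ b ∷ [])
  midpoint-geodesic w≢1 a≢b mid = length-2-geodesic w≢1 a≢b (midpoint-path mid a≢b) (midpoint-len mid)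

  double-edge-geodesic : ∀ {a b} → weight G a b ≡ 2 → a ≢ b → IsGeodesic G a b (a ∷ b ∷ [])
  double-edge-geodesic w≡2 a≢b =
    length-2-geodesic (λ w≡1 → contradiction (trans (sym w≡2) w≡1) λ ()) a≢b
      (edge-path (suc⇒nonzero w≡2) a≢b) (trans edge-len w≡2)

  UniqueGeodesic : Fin (n G) → Fin (n G) → Set
  UniqueGeodesic u v = Σ (List (Fin (n G))) λ vs →
    IsGeodesic G u v vs × (∀ ws → IsGeodesic G u v ws → ws ≡ vs)

  unique-short-path⇒unique-geodesic : ∀ {u v} P → IsPath G u v P →
    (∀ Q → IsPath G u v Q → len G Q ≤ len G P → Q ≡ P) → UniqueGeodesic u v
  unique-short-path⇒unique-geodesic {u} {v} P path only =
    P , (path , shortest) , λ Q geo → only Q (proj₁ geo) (proj₂ geo P path)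
    where
    shortest : ∀ Q → IsPath G u v Q → len G P ≤ len G Q
    shortest Q q = ≮⇒≥ λ lt → <-irrefl (cong (len G) (only Q q (<⇒≤ lt))) lt

  only-short-walk⇒unique-geodesic : ∀ {u v} P → IsPath G u v P → len G P ≤ 2 → u ≢ v →
    (∀ {Q} → ShortWalk u v Q → len G Q ≤ len G P → Q ≡ P) → UniqueGeodesic u v
  only-short-walk⇒unique-geodesic P path P≤2 u≢v only =
    unique-short-path⇒unique-geodesic P path
      λ Q q Q≤P → only (short-walk (proj₁ q) u≢v (≤-trans Q≤P P≤2)) Q≤P

  shortRoute⇒unique-geodesic : ∀ {u v} → u ≢ v → ShortRoute (weight G) u v → UniqueGeodesic u v
  shortRoute⇒unique-geodesic {u} {v} u≢v (unit-edge w≡1) =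
    only-short-walk⇒unique-geodesic _ (edge-path (suc⇒nonzero w≡1) u≢v)
      (subst (_≤ 2) (sym edge-len) (short⇒≤2 (inj₁ w≡1))) u≢v only
    where
    only : ∀ {Q} → ShortWalk u v Q → len G Q ≤ len G (u ∷ v ∷ []) → Q ≡ u ∷ v ∷ []
    only (edge _)    _ = refl
    only (via _ mid) le with s≤s () ← subst₂ _≤_ (midpoint-len mid) (trans edge-len w≡1) le
  shortRoute⇒unique-geodesic {u} {v} u≢v (double-edge w≡2 none) =
    only-short-walk⇒unique-geodesic _ (edge-path (suc⇒nonzero w≡2) u≢v)
      (subst (_≤ 2) (sym edge-len) (short⇒≤2 (inj₂ w≡2))) u≢v only
    where
    only : ∀ {Q} → ShortWalk u v Q → len G Q ≤ len G (u ∷ v ∷ []) → Q ≡ u ∷ v ∷ []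
    only (edge _)    _ = refl
    only (via m mid) _ = contradiction mid (none m)
  shortRoute⇒unique-geodesic {u} {v} u≢v (unique-midpoint m mid ¬short unique) =
    only-short-walk⇒unique-geodesic _ (midpoint-path mid u≢v) (≤-reflexive (midpoint-len mid)) u≢v only
    where
    only : ∀ {Q} → ShortWalk u v Q → len G Q ≤ len G (u ∷ m ∷ v ∷ []) → Q ≡ u ∷ m ∷ v ∷ []
    only (edge short)  _ = contradiction short ¬short
    only (via m′ mid′) _ = cong (λ z → u ∷ z ∷ v ∷ []) (unique m′ mid′)

  shortRoutes⇒geodetic : (∀ u v → u ≢ v → ShortRoute (weight G) u v) → Geodetic G
  shortRoutes⇒geodetic routes u v with u Fin.≟ v
  ... | yes refl = unique-short-path⇒unique-geodesic (u ∷ []) (here , [] ∷ [])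
                     λ Q q → trivial-walk (proj₁ q)
  ... | no u≢v   = shortRoute⇒unique-geodesic u≢v (routes u v u≢v)

module _ {A : Set} {N : ℕ} (e : Fin N ↔ A) where
  open Inverse e

  graphOn : (w : A → A → ℕ) → (∀ u v → w u v ≡ w v u) → (∀ u → w u u ≡ 0) → WGraph
  graphOn w w-sym w-loopless = record
    { n        = N
    ; weight   = λ i j → w (to i) (to j)
    ; sym      = λ i j → w-sym (to i) (to j)
    ; loopless = w-loopless ∘ to
    }

  graphOn-geodetic : ∀ w w-sym w-loopless → (∀ u v → u ≢ v → ShortRoute w u v) →
                     Geodetic (graphOn w w-sym w-loopless)
  graphOn-geodetic _ _ _ routes = shortRoutes⇒geodetic _ λ i j i≢j →
    shortRoute-reindex e (routes (to i) (to j) (i≢j ∘ Injection.injective (↔⇒↣ e)))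

module Construction (H : WGraph) where

  OldVertex : Set
  OldVertex = Fin (n H)

  Pair : Set
  Pair = OldVertex × OldVertex

  _≟ₚ_ : (x y : Pair) → Dec (x ≡ y)
  _≟ₚ_ = ≡-dec Fin._≟_ Fin._≟_

  midpoint? : ∀ a c b → Dec (Midpoint (weight H) a c b)
  midpoint? a c b = (weight H a c ℕ.≟ 1) ×-dec (weight H c b ℕ.≟ 1)

  Far : OldVertex → OldVertex → Set
  Far a b = ¬ ShortWeight (weight H a b) × (∀ c → ¬ Midpoint (weight H) a c b)

  far? : ∀ a b → Dec (Far a b)
  far? a b = ¬? ((weight H a b ℕ.≟ 1) ⊎-dec (weight H a b ℕ.≟ 2))
       ×-dec all? (λ c → ¬? (midpoint? a c b))

  Far-sym : ∀ {a b} → Far a b → Far b a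
  Far-sym {a} {b} (¬short , ¬mid) =
    ¬short ∘ subst ShortWeight (WGraph.sym H b a) , λ c → ¬mid c ∘ midpoint-sym (WGraph.sym H)

  Active : Pair → Set
  Active (p , q) = p Fin.< q × Far p q

  Endpoint : Pair → OldVertex → Set
  Endpoint (p , q) a = Active (p , q) × (a ≡ p ⊎ a ≡ q)

  endpoint? : ∀ x a → Dec (Endpoint x a)
  endpoint? (p , q) a = ((p Fin.<? q) ×-dec far? p q) ×-dec ((a Fin.≟ p) ⊎-dec (a Fin.≟ q))

  NearEndpoint : Pair → OldVertex → Set
  NearEndpoint x a = ∃[ b ] (Endpoint x b × weight H b a ≡ 1)

  nearEndpoint? : ∀ x a → Dec (NearEndpoint x a)
  nearEndpoint? x a = any? λ b → endpoint? x b ×-dec (weight H b a ℕ.≟ 1)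

  CommonEndpoint : Pair → Pair → Set
  CommonEndpoint x y = ∃[ a ] (Endpoint x a × Endpoint y a)

  commonEndpoint? : ∀ x y → Dec (CommonEndpoint x y)
  commonEndpoint? x y = any? λ a → endpoint? x a ×-dec endpoint? y a

  commonEndpoint-sym : ∀ {x y} → CommonEndpoint x y → CommonEndpoint y x
  commonEndpoint-sym (a , xa , ya) = a , ya , xa

  far-pair : ∀ {a b} → a ≢ b → Far a b → ∃[ x ] (Endpoint x a × Endpoint x b)
  far-pair {a} {b} a≢b far with <-cmp a b
  ... | tri< a<b _ _ = (a , b) , ((a<b , far) , inj₁ refl) , ((a<b , far) , inj₂ refl)
  ... | tri≈ _ a≡b _ = contradiction a≡b a≢b
  ... | tri> _ _ b<a = (b , a) , ((b<a , Far-sym far) , inj₂ refl) , ((b<a , Far-sym far) , inj₁ refl)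

  endpoints-of : ∀ {x a b} → Endpoint x a → Endpoint x b → a ≢ b →
                 (Active (a , b) × x ≡ (a , b)) ⊎ (Active (b , a) × x ≡ (b , a))
  endpoints-of (_   , inj₁ refl) (_ , inj₁ refl) a≢b = contradiction refl a≢b
  endpoints-of (act , inj₁ refl) (_ , inj₂ refl) _   = inj₁ (act , refl)
  endpoints-of (act , inj₂ refl) (_ , inj₁ refl) _   = inj₂ (act , refl)
  endpoints-of (_   , inj₂ refl) (_ , inj₂ refl) a≢b = contradiction refl a≢b

  endpoints-far : ∀ {x a b} → Endpoint x a → Endpoint x b → a ≢ b → Far a b
  endpoints-far xa xb a≢b with endpoints-of xa xb a≢b
  ... | inj₁ ((_ , far) , _) = far
  ... | inj₂ ((_ , far) , _) = Far-sym far

  endpoints-determine-pair : ∀ {x y a b} → Endpoint x a → Endpoint x b →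
                             Endpoint y a → Endpoint y b → a ≢ b → x ≡ y
  endpoints-determine-pair xa xb ya yb a≢b with endpoints-of xa xb a≢b | endpoints-of ya yb a≢b
  ... | inj₁ (_ , refl)      | inj₁ (_ , refl)      = refl
  ... | inj₁ ((a<b , _) , _) | inj₂ ((b<a , _) , _) = contradiction b<a (<-asym a<b)
  ... | inj₂ ((b<a , _) , _) | inj₁ ((a<b , _) , _) = contradiction b<a (<-asym a<b)
  ... | inj₂ (_ , refl)      | inj₂ (_ , refl)      = refl

  -- Every ordered pair gets a new vertex, but only active pairs (p < q, so one per unordered
  -- far pair) have unit edges; the other new vertices are at distance 2 from everything.
  Vertex : Set
  Vertex = OldVertex ⊎ Pair

  pattern old a = inj₁ a
  pattern new x = inj₂ x

  newToOld : Pair → OldVertex → ℕ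
  newToOld x a = if does (endpoint? x a) then 1 else if does (nearEndpoint? x a) then 0 else 2

  newToNew : Pair → Pair → ℕ
  newToNew x y = if does (x ≟ₚ y) then 0 else if does (commonEndpoint? x y) then 0 else 2

  W : Vertex → Vertex → ℕ
  W (old a) (old b) = weight H a b
  W (old a) (new y) = newToOld y a
  W (new x) (old b) = newToOld x b
  W (new x) (new y) = newToNew x y

  W-sym : ∀ u v → W u v ≡ W v u
  W-sym (old a) (old b) = WGraph.sym H a b
  W-sym (old a) (new y) = refl
  W-sym (new x) (old b) = refl
  W-sym (new x) (new y)
    rewrite does-⇔ (mk⇔ sym sym) (x ≟ₚ y) (y ≟ₚ x)
          | does-⇔ (mk⇔ commonEndpoint-sym commonEndpoint-sym)
                   (commonEndpoint? x y) (commonEndpoint? y x) = refl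

  W-loopless : ∀ u → W u u ≡ 0
  W-loopless (old a) = loopless H a
  W-loopless (new x) rewrite dec-true (x ≟ₚ x) refl = refl

  endpoint⇒newToOld≡1 : ∀ {x a} → Endpoint x a → newToOld x a ≡ 1
  endpoint⇒newToOld≡1 {x} {a} xa rewrite dec-true (endpoint? x a) xa = refl

  near⇒newToOld≡0 : ∀ {x a} → ¬ Endpoint x a → NearEndpoint x a → newToOld x a ≡ 0
  near⇒newToOld≡0 {x} {a} ¬xa near
    rewrite dec-false (endpoint? x a) ¬xa | dec-true (nearEndpoint? x a) near = refl

  ¬near⇒newToOld≡2 : ∀ {x a} → ¬ Endpoint x a → ¬ NearEndpoint x a → newToOld x a ≡ 2
  ¬near⇒newToOld≡2 {x} {a} ¬xa ¬near
    rewrite dec-false (endpoint? x a) ¬xa | dec-false (nearEndpoint? x a) ¬near = refl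

  newToOld≡1⇒endpoint : ∀ x a → newToOld x a ≡ 1 → Endpoint x a
  newToOld≡1⇒endpoint x a =
    if-does-resolve (endpoint? x a) (if-both {P = _≢ 1} (does (nearEndpoint? x a)) (λ ()) (λ ()))

  newToOld≤2 : ∀ x a → newToOld x a ≤ 2
  newToOld≤2 x a =
    if-both {P = _≤ 2} (does (endpoint? x a)) (s≤s z≤n)
      (if-both {P = _≤ 2} (does (nearEndpoint? x a)) z≤n ≤-refl)

  common⇒newToNew≡0 : ∀ {x y} → x ≢ y → CommonEndpoint x y → newToNew x y ≡ 0
  common⇒newToNew≡0 {x} {y} x≢y common
    rewrite dec-false (x ≟ₚ y) x≢y | dec-true (commonEndpoint? x y) common = refl

  ¬common⇒newToNew≡2 : ∀ {x y} → x ≢ y → ¬ CommonEndpoint x y → newToNew x y ≡ 2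
  ¬common⇒newToNew≡2 {x} {y} x≢y ¬common
    rewrite dec-false (x ≟ₚ y) x≢y | dec-false (commonEndpoint? x y) ¬common = refl

  newToNew≤2 : ∀ x y → newToNew x y ≤ 2
  newToNew≤2 x y =
    if-both {P = _≤ 2} (does (x ≟ₚ y)) z≤n
      (if-both {P = _≤ 2} (does (commonEndpoint? x y)) z≤n ≤-refl)

  newToNew≢1 : ∀ x y → newToNew x y ≢ 1
  newToNew≢1 x y =
    if-both {P = _≢ 1} (does (x ≟ₚ y)) (λ ())
      (if-both {P = _≢ 1} (does (commonEndpoint? x y)) (λ ()) (λ ()))

  new-midpoint-far : ∀ {a b} x → a ≢ b → Midpoint W (old a) (new x) (old b) → Far a b
  new-midpoint-far {a} {b} x a≢b (xa , xb) =
    endpoints-far (newToOld≡1⇒endpoint x a xa) (newToOld≡1⇒endpoint x b xb) a≢b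

  shortRoute-old : NoTwoGeodesicsOfLength2 H → ∀ {a b} → a ≢ b → ShortRoute W (old a) (old b)
  shortRoute-old unique₂ {a} {b} a≢b
    with weight H a b ℕ.≟ 1 | weight H a b ℕ.≟ 2 | any? (λ c → midpoint? a c b)
  ... | yes w≡1 | _       | _ = unit-edge w≡1
  ... | no w≢1  | yes w≡2 | _ = double-edge w≡2 no-midpoint
    where
    no-midpoint : ∀ m → ¬ Midpoint W (old a) m (old b)
    no-midpoint (old c) mid
      with () ← unique₂ a b _ _ (midpoint-geodesic H w≢1 a≢b mid) (midpoint-len H mid)
                                (double-edge-geodesic H w≡2 a≢b) (trans (edge-len H) w≡2)
    no-midpoint (new x) mid = proj₁ (new-midpoint-far x a≢b mid) (inj₂ w≡2)
  ... | no w≢1  | no w≢2  | yes (c , mid) = unique-midpoint (old c) mid [ w≢1 , w≢2 ]′ only-c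
    where
    only-c : ∀ m → Midpoint W (old a) m (old b) → m ≡ old c
    only-c (old c′) mid′
      with refl ← unique₂ a b _ _ (midpoint-geodesic H w≢1 a≢b mid′) (midpoint-len H mid′)
                                  (midpoint-geodesic H w≢1 a≢b mid) (midpoint-len H mid) = refl
    only-c (new x) mid′ = contradiction mid (proj₂ (new-midpoint-far x a≢b mid′) c)
  ... | no w≢1  | no w≢2  | no ¬mid
    with x , xa , xb ← far-pair a≢b ([ w≢1 , w≢2 ]′ , λ c → ¬mid ∘ (c ,_)) =
    unique-midpoint (new x) (endpoint⇒newToOld≡1 xa , endpoint⇒newToOld≡1 xb) [ w≢1 , w≢2 ]′ only-x
    where
    only-x : ∀ m → Midpoint W (old a) m (old b) → m ≡ new x
    only-x (old c) mid = contradiction (c , mid) ¬mid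
    only-x (new y) (ya , yb) =
      cong new (endpoints-determine-pair (newToOld≡1⇒endpoint y a ya) (newToOld≡1⇒endpoint y b yb)
                                         xa xb a≢b)

  shortRoute-new-old : ∀ x a → ShortRoute W (new x) (old a)
  shortRoute-new-old x a with endpoint? x a | nearEndpoint? x a
  ... | yes xa | _ = unit-edge (endpoint⇒newToOld≡1 xa)
  ... | no ¬xa | yes near@(b , xb , ba) =
    unique-midpoint (old b) (endpoint⇒newToOld≡1 xb , ba)
      (zero⇒¬short (near⇒newToOld≡0 ¬xa near)) only-b
    where
    only-b : ∀ m → Midpoint W (new x) m (old a) → m ≡ old b
    only-b (old c) (xc , ca) with c Fin.≟ b
    ... | yes refl = refl
    ... | no c≢b   = contradiction (ca , trans (WGraph.sym H a b) ba)
                                   (proj₂ (endpoints-far (newToOld≡1⇒endpoint x c xc) xb c≢b) a)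
    only-b (new y) (xy , _) = contradiction xy (newToNew≢1 x y)
  ... | no ¬xa | no ¬near = double-edge (¬near⇒newToOld≡2 ¬xa ¬near) no-midpoint
    where
    no-midpoint : ∀ m → ¬ Midpoint W (new x) m (old a)
    no-midpoint (old c) (xc , ca) = ¬near (c , newToOld≡1⇒endpoint x c xc , ca)
    no-midpoint (new y) (xy , _)  = newToNew≢1 x y xy

  shortRoute-new-new : ∀ {x y} → x ≢ y → ShortRoute W (new x) (new y)
  shortRoute-new-new {x} {y} x≢y with commonEndpoint? x y
  ... | yes common@(a , xa , ya) =
    unique-midpoint (old a) (endpoint⇒newToOld≡1 xa , endpoint⇒newToOld≡1 ya)
      (zero⇒¬short (common⇒newToNew≡0 x≢y common)) only-a
    where
    only-a : ∀ m → Midpoint W (new x) m (new y) → m ≡ old a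
    only-a (old c) (xc , yc) with c Fin.≟ a
    ... | yes refl = refl
    ... | no c≢a   = contradiction (endpoints-determine-pair (newToOld≡1⇒endpoint x c xc) xa
                                                              (newToOld≡1⇒endpoint y c yc) ya c≢a) x≢y
    only-a (new z) (xz , _) = contradiction xz (newToNew≢1 x z)
  ... | no ¬common = double-edge (¬common⇒newToNew≡2 x≢y ¬common) no-midpoint
    where
    no-midpoint : ∀ m → ¬ Midpoint W (new x) m (new y)
    no-midpoint (old c) (xc , yc) =
      ¬common (c , newToOld≡1⇒endpoint x c xc , newToOld≡1⇒endpoint y c yc)
    no-midpoint (new z) (xz , _)  = newToNew≢1 x z xz

  shortRoutes : NoTwoGeodesicsOfLength2 H → ∀ u v → u ≢ v → ShortRoute W u v
  shortRoutes unique₂ (old a) (old b) u≢v = shortRoute-old unique₂ (u≢v ∘ cong old)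
  shortRoutes _       (old a) (new y) _   = shortRoute-sym W-sym (shortRoute-new-old y a)
  shortRoutes _       (new x) (old b) _   = shortRoute-new-old x b
  shortRoutes _       (new x) (new y) u≢v = shortRoute-new-new (u≢v ∘ cong new)

  W≤2-off-H : ∀ u v → (∀ a b → u ≡ old a → v ≡ old b → ⊥) → W u v ≤ 2
  W≤2-off-H (old a) (old b) off-H = ⊥-elim (off-H a b refl refl)
  W≤2-off-H (old a) (new y) _     = newToOld≤2 y a
  W≤2-off-H (new x) (old b) _     = newToOld≤2 x b
  W≤2-off-H (new x) (new y) _     = newToNew≤2 x y

  vertex-enc : Fin (n H + n H * n H) ↔ Vertex
  vertex-enc = ↔-trans +↔⊎ (↔-refl ⊎-↔ *↔×)

  G : WGraph
  G = graphOn vertex-enc W W-sym W-loopless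

  open Inverse vertex-enc

  embed : Fin (n H) → Fin (n G)
  embed a = from (old a)

  embed-induced : InducedEmbedding H G embed
  embed-induced = (λ e → inj₁-injective (Injection.injective (↔⇒↣ (↔-sym vertex-enc)) e)) ,
                  λ i j → cong₂ W (strictlyInverseˡ (old i)) (strictlyInverseˡ (old j))

  new-edges : NewEdgesWeight1or2 H G embed
  new-edges i j adj not-in-H = nonzero≤2⇒short adj (W≤2-off-H (to i) (to j) in-H)
    where
    in-H : ∀ a b → to i ≡ old a → to j ≡ old b → ⊥
    in-H a b ia jb =
      not-in-H (a , b , from-old ia , from-old jb , subst₂ (λ u v → W u v ≢ 0) ia jb adj)
      where
      from-old : ∀ {k c} → to k ≡ old c → embed c ≡ k
      from-old {k} eq = trans (cong from (sym eq)) (strictlyInverseʳ k)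

theorem9 : (H : WGraph) → NoTwoGeodesicsOfLength2 H →
    Σ WGraph λ G → Σ (Fin (n H) → Fin (n G)) λ f →
      InducedEmbedding H G f × Geodetic G × NewEdgesWeight1or2 H G f
theorem9 H unique₂ = G , embed , embed-induced , geodetic , new-edges
  where
  open Construction H
  geodetic : Geodetic G
  geodetic = graphOn-geodetic vertex-enc W W-sym W-loopless (shortRoutes unique₂)
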